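{- For every non-negative integer $n$, \[ H_n=\frac{1}{2}\sum_{k=1}^{n}(-1)^{n+k}\binom{n}{k}\binom{n+k}{k}H_k . \]
   Context: $H_k=\sum_{j=1}^{k}\frac{1}{j}$ denotes the $k$-th harmonic number, with $H_0=0$. -}

module Defs where

open import Data.Nat as ℕ using (ℕ; zero; suc)
open import Data.Nat.Combinatorics using (_C_)
open import Data.Integer as ℤ using (ℤ; +_)
open import Data.Rational using (ℚ; _/_; _+_; _*_; -_; 0ℚ; 1ℚ)

H : ℕ → ℚ
H zero    = 0ℚ
H (suc j) = H j + (+ 1 / suc j)

toℚ : ℕ → ℚ
toℚ m = + m / 1

sign : ℕ → ℚ
sign zero    = 1ℚ
sign (suc m) = - sign m

sum1 : ℕ → (ℕ → ℚ) → ℚ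
sum1 zero    f = 0ℚ
sum1 (suc m) f = sum1 m f + f (suc m)

-- With a(n,k) = (-1)^(n+k) C(n,k) C(n+k,k), the claim is S(n) = 2 H_n for
-- S(n) = Σ_{k=1}^{n} a(n,k) H_k.  The quotients a(n+1,k+1)/a(n,k) and a(n,k+1)/a(n,k)
-- are explicit rational functions of n and k, from which
--   (n+1) (a(n+1,k) - a(n,k)) = 2 (P(n,k) - P(n,k+1)),   P(n,k) = (n+k) a(n,k-1),  P(n,0) = 0.
-- Summed over k this gives Σ_k a(n,k) = 1 by induction on n.  Summed against H_k, Abel
-- summation with H_k - H_{k-1} = 1/k turns (n+1) (S(n+1) - S(n)) into
--   2 Σ_j (n+j+1) a(n,j)/(j+1) = 2 Σ_j a(n,j) + 2n Σ_j a(n,j)/(j+1),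
-- and the last sum vanishes because (n+1) n a(n,j)/(j+1) telescopes as
-- j a(n,j) - (j+1) a(n,j+1).  So S(n+1) - S(n) = 2/(n+1).

module Submission where

open import Defs
open import Data.Nat as ℕ using (ℕ)
open import Data.Nat.Combinatorics using (_C_)
open import Data.Rational using (ℚ; _*_; ½)
open import Relation.Binary.PropositionalEquality using (_≡_)

open import Algebra.Bundles using (CommutativeMonoid)
import Data.Integer as ℤ
import Data.Integer.Properties as ℤ
open import Data.List.Base using (_∷_; [])
open import Data.Nat.Base using (zero; suc; pred)
open import Data.Nat.Combinatorics using (nCk+nC[k+1]≡[n+1]C[k+1]; nC1≡n; nCk≡nC[n∸k])
open import Data.Nat.Combinatorics.Specification using (k>n⇒nCk≡0)
import Data.Nat.Coprimality as Coprime
import Data.Nat.Properties as ℕ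
open import Data.Rational using (_+_; _-_; -_; 0ℚ; 1ℚ; mkℚ; _/_)
import Data.Rational.Properties as ℚ
open import Level using (0ℓ)
open import Relation.Binary.PropositionalEquality using (refl; sym; trans; cong; cong₂; module ≡-Reasoning)
open import Relation.Nullary.Decidable using (dec⇒maybe)
open import Tactic.RingSolver using (solve; solve-∀)
open import Tactic.RingSolver.Core.AlmostCommutativeRing using (AlmostCommutativeRing; fromCommutativeRing)

open import Algebra.Properties.Group ℚ.+-0-group using (x∙y⁻¹≈ε⇒x≈y)
open import Algebra.Properties.CommutativeSemigroup
  (CommutativeMonoid.commutativeSemigroup ℚ.*-1-commutativeMonoid) using (interchange; x∙yz≈y∙xz)

open ≡-Reasoning

-- The reflective solver treats only variables as atoms, so each ring step below is proved
-- for abstract rationals (N, K, c, …) in a local lemma and then instantiated.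
ℚ-ring : AlmostCommutativeRing 0ℓ 0ℓ
ℚ-ring = fromCommutativeRing ℚ.+-*-commutativeRing (λ x → dec⇒maybe (0ℚ ℚ.≟ x))

2ℚ : ℚ
2ℚ = 1ℚ + 1ℚ

-- Finite sums

sum0 : ℕ → (ℕ → ℚ) → ℚ
sum0 m f = sum1 (suc m) (λ k → f (pred k))

sum1-cong : ∀ m {f g : ℕ → ℚ} → (∀ k → f (suc k) ≡ g (suc k)) → sum1 m f ≡ sum1 m g
sum1-cong zero    eq = refl
sum1-cong (suc m) eq = cong₂ _+_ (sum1-cong m eq) (eq m)

sum1-*ˡ : ∀ m x (f : ℕ → ℚ) → sum1 m (λ k → x * f k) ≡ x * sum1 m f
sum1-*ˡ zero    x f = sym (ℚ.*-zeroʳ x)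
sum1-*ˡ (suc m) x f =
  trans (cong (_+ x * f (suc m)) (sum1-*ˡ m x f)) (sym (ℚ.*-distribˡ-+ x (sum1 m f) (f (suc m))))

sum1-+ : ∀ m (f g : ℕ → ℚ) → sum1 m (λ k → f k + g k) ≡ sum1 m f + sum1 m g
sum1-+ zero    f g = refl
sum1-+ (suc m) f g = trans (cong (_+ (f (suc m) + g (suc m))) (sum1-+ m f g))
                           (step (sum1 m f) (sum1 m g) (f (suc m)) (g (suc m)))
  where
  step : ∀ x y u v → (x + y) + (u + v) ≡ (x + u) + (y + v)
  step = solve-∀ ℚ-ring

sum1-- : ∀ m (f g : ℕ → ℚ) → sum1 m (λ k → f k - g k) ≡ sum1 m f - sum1 m g
sum1-- zero    f g = refl
sum1-- (suc m) f g = trans (cong (_+ (f (suc m) - g (suc m))) (sum1-- m f g))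
                           (step (sum1 m f) (sum1 m g) (f (suc m)) (g (suc m)))
  where
  step : ∀ x y u v → (x - y) + (u - v) ≡ (x + u) - (y + v)
  step = solve-∀ ℚ-ring

sum0-telescope : ∀ m (g : ℕ → ℚ) → sum0 m (λ k → g k - g (suc k)) ≡ g 0 - g (suc m)
sum0-telescope zero    g = ℚ.+-identityˡ (g 0 - g 1)
sum0-telescope (suc m) g = trans (cong (_+ (g (suc m) - g (suc (suc m)))) (sum0-telescope m g))
                                 (step (g 0) (g (suc m)) (g (suc (suc m))))
  where
  step : ∀ x y z → (x - y) + (y - z) ≡ x - z
  step = solve-∀ ℚ-ring

sum1-by-parts : ∀ m (p h : ℕ → ℚ) →
  sum1 m (λ k → (p k - p (suc k)) * h k)
  ≡ sum1 m (λ k → p k * (h k - h (pred k))) + (p 1 * h 0 - p (suc m) * h m)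
sum1-by-parts zero    p h = step (p 1 * h 0)
  where
  step : ∀ x → 0ℚ ≡ 0ℚ + (x - x)
  step = solve-∀ ℚ-ring
sum1-by-parts (suc m) p h = begin
  sum1 m (λ k → (p k - p (suc k)) * h k) + (p (suc m) - p (suc (suc m))) * h (suc m)
    ≡⟨ cong (_+ (p (suc m) - p (suc (suc m))) * h (suc m)) (sum1-by-parts m p h) ⟩
  Σ + (p 1 * h 0 - p (suc m) * h m) + (p (suc m) - p (suc (suc m))) * h (suc m)
    ≡⟨ step Σ (p 1 * h 0) (p (suc m)) (p (suc (suc m))) (h m) (h (suc m)) ⟩
  Σ + p (suc m) * (h (suc m) - h m) + (p 1 * h 0 - p (suc (suc m)) * h (suc m))
    ∎
  where
  Σ = sum1 m (λ k → p k * (h k - h (pred k)))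
  step : ∀ s b x y u v → s + (b - x * u) + (x - y) * v ≡ s + x * (v - u) + (b - y * v)
  step = solve-∀ ℚ-ring

-- Binomial coefficients

[k+1]*[n+1]C[k+1]≡[n+1]*nCk : ∀ n k → suc k ℕ.* (suc n C suc k) ≡ suc n ℕ.* (n C k)
[k+1]*[n+1]C[k+1]≡[n+1]*nCk zero    zero    = refl
[k+1]*[n+1]C[k+1]≡[n+1]*nCk zero    (suc k) = ℕ.*-zeroʳ (suc (suc k))
[k+1]*[n+1]C[k+1]≡[n+1]*nCk (suc n) zero    =
  trans (ℕ.+-identityʳ _) (trans (nC1≡n (suc (suc n))) (sym (ℕ.*-identityʳ _)))
[k+1]*[n+1]C[k+1]≡[n+1]*nCk (suc n) (suc k) = begin
  suc (suc k) ℕ.* (suc (suc n) C suc (suc k))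
    ≡⟨ cong (suc (suc k) ℕ.*_) (nCk+nC[k+1]≡[n+1]C[k+1] (suc n) (suc k)) ⟨
  suc (suc k) ℕ.* (X ℕ.+ Y)
    ≡⟨ ℕ.*-distribˡ-+ (suc (suc k)) X Y ⟩
  X ℕ.+ suc k ℕ.* X ℕ.+ suc (suc k) ℕ.* Y
    ≡⟨ cong₂ (λ u v → X ℕ.+ u ℕ.+ v) ([k+1]*[n+1]C[k+1]≡[n+1]*nCk n k)
                                      ([k+1]*[n+1]C[k+1]≡[n+1]*nCk n (suc k)) ⟩
  X ℕ.+ suc n ℕ.* (n C k) ℕ.+ suc n ℕ.* (n C suc k)
    ≡⟨ ℕ.+-assoc X _ _ ⟩
  X ℕ.+ (suc n ℕ.* (n C k) ℕ.+ suc n ℕ.* (n C suc k))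
    ≡⟨ cong (X ℕ.+_) (ℕ.*-distribˡ-+ (suc n) (n C k) (n C suc k)) ⟨
  X ℕ.+ suc n ℕ.* (n C k ℕ.+ n C suc k)
    ≡⟨ cong (λ z → X ℕ.+ suc n ℕ.* z) (nCk+nC[k+1]≡[n+1]C[k+1] n k) ⟩
  suc (suc n) ℕ.* X
    ∎
  where
  X = suc n C suc k
  Y = suc n C suc (suc k)

[m+n]Cn≡[m+n]Cm : ∀ m n → (m ℕ.+ n) C n ≡ (m ℕ.+ n) C m
[m+n]Cn≡[m+n]Cm m n =
  trans (nCk≡nC[n∸k] (ℕ.m≤n+m n m)) (cong ((m ℕ.+ n) C_) (ℕ.m+n∸n≡m m n))

[n+1]*[n+k+1]Ck≡[n+k+1]*[n+k]Ck : ∀ n k →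
  suc n ℕ.* ((n ℕ.+ suc k) C k) ≡ (n ℕ.+ suc k) ℕ.* ((n ℕ.+ k) C k)
[n+1]*[n+k+1]Ck≡[n+k+1]*[n+k]Ck n k rewrite ℕ.+-suc n k = begin
  suc n ℕ.* (suc (n ℕ.+ k) C k)       ≡⟨ cong (suc n ℕ.*_) ([m+n]Cn≡[m+n]Cm (suc n) k) ⟩
  suc n ℕ.* (suc (n ℕ.+ k) C suc n)   ≡⟨ [k+1]*[n+1]C[k+1]≡[n+1]*nCk (n ℕ.+ k) n ⟩
  suc (n ℕ.+ k) ℕ.* ((n ℕ.+ k) C n)   ≡⟨ cong (suc (n ℕ.+ k) ℕ.*_) ([m+n]Cn≡[m+n]Cm n k) ⟨
  suc (n ℕ.+ k) ℕ.* ((n ℕ.+ k) C k)   ∎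

toℚ≡mkℚ : ∀ m → toℚ m ≡ mkℚ (ℤ.+ m) 0 (Coprime.sym (Coprime.1-coprimeTo m))
toℚ≡mkℚ m = ℚ.normalize-coprime (Coprime.sym (Coprime.1-coprimeTo m))

toℚ-+ : ∀ m n → toℚ (m ℕ.+ n) ≡ toℚ m + toℚ n
toℚ-+ m n rewrite toℚ≡mkℚ m | toℚ≡mkℚ n =
  cong₂ (λ i j → (i ℤ.+ j) / 1) (sym (ℤ.*-identityʳ (ℤ.+ m))) (sym (ℤ.*-identityʳ (ℤ.+ n)))

toℚ-* : ∀ m n → toℚ (m ℕ.* n) ≡ toℚ m * toℚ n
toℚ-* m n rewrite toℚ≡mkℚ m | toℚ≡mkℚ n = cong (_/ 1) (ℤ.pos-* m n)

toℚ-suc : ∀ m → toℚ (suc m) ≡ 1ℚ + toℚ m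
toℚ-suc = toℚ-+ 1

toℚ-+-suc : ∀ m n → toℚ (m ℕ.+ suc n) ≡ 1ℚ + (toℚ m + toℚ n)
toℚ-+-suc m n =
  trans (cong toℚ (ℕ.+-suc m n)) (trans (toℚ-suc (m ℕ.+ n)) (cong (1ℚ +_) (toℚ-+ m n)))

toℚ-*-≡ : ∀ m x n y → m ℕ.* x ≡ n ℕ.* y → toℚ m * toℚ x ≡ toℚ n * toℚ y
toℚ-*-≡ m x n y eq = trans (sym (toℚ-* m x)) (trans (cong toℚ eq) (toℚ-* n y))

1/suc : ℕ → ℚ
1/suc k = ℤ.+ 1 / suc k

[1+k]*1/suc≡1 : ∀ k → (1ℚ + toℚ k) * 1/suc k ≡ 1ℚ
[1+k]*1/suc≡1 k rewrite sym (toℚ-suc k) | toℚ≡mkℚ (suc k)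
  | ℚ.normalize-coprime {1} {k} (Coprime.1-coprimeTo (suc k)) =
  ℚ.*-inverseʳ (mkℚ (ℤ.+ suc k) 0 (Coprime.sym (Coprime.1-coprimeTo (suc k))))

*-cancelˡ-invertible : ∀ {c d x y} → d * c ≡ 1ℚ → c * x ≡ c * y → x ≡ y
*-cancelˡ-invertible {c} {d} {x} {y} dc≡1 cx≡cy = begin
  x            ≡⟨ ℚ.*-identityˡ x ⟨
  1ℚ * x       ≡⟨ cong (_* x) dc≡1 ⟨
  d * c * x    ≡⟨ ℚ.*-assoc d c x ⟩
  d * (c * x)  ≡⟨ cong (d *_) cx≡cy ⟩
  d * (c * y)  ≡⟨ ℚ.*-assoc d c y ⟨
  d * c * y    ≡⟨ cong (_* y) dc≡1 ⟩
  1ℚ * y       ≡⟨ ℚ.*-identityˡ y ⟩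
  y            ∎

*-cancelˡ-[1+k] : ∀ k {x y} → (1ℚ + toℚ k) * x ≡ (1ℚ + toℚ k) * y → x ≡ y
*-cancelˡ-[1+k] k = *-cancelˡ-invertible {1ℚ + toℚ k} {1/suc k}
  (trans (ℚ.*-comm (1/suc k) (1ℚ + toℚ k)) ([1+k]*1/suc≡1 k))

absorption : ∀ m k → (1ℚ + toℚ k) * toℚ (suc m C suc k) ≡ (1ℚ + toℚ m) * toℚ (m C k)
absorption m k rewrite sym (toℚ-suc k) | sym (toℚ-suc m) =
  toℚ-*-≡ (suc k) (suc m C suc k) (suc m) (m C k) ([k+1]*[n+1]C[k+1]≡[n+1]*nCk m k)

absorption-below : ∀ m k → (1ℚ + toℚ k) * toℚ (m C suc k) ≡ (toℚ m - toℚ k) * toℚ (m C k)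
absorption-below m k = subtract (toℚ m) (toℚ k) (toℚ (m C k)) (toℚ (m C suc k)) (begin
  (1ℚ + toℚ k) * (toℚ (m C k) + toℚ (m C suc k))
    ≡⟨ cong ((1ℚ + toℚ k) *_) (toℚ-+ (m C k) (m C suc k)) ⟨
  (1ℚ + toℚ k) * toℚ (m C k ℕ.+ m C suc k)
    ≡⟨ cong (λ z → (1ℚ + toℚ k) * toℚ z) (nCk+nC[k+1]≡[n+1]C[k+1] m k) ⟩
  (1ℚ + toℚ k) * toℚ (suc m C suc k)
    ≡⟨ absorption m k ⟩
  (1ℚ + toℚ m) * toℚ (m C k)
    ∎)
  where
  subtract : ∀ M K u y → (1ℚ + K) * (u + y) ≡ (1ℚ + M) * u → (1ℚ + K) * y ≡ (M - K) * u
  subtract M K u y eq = begin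
    (1ℚ + K) * y                       ≡⟨ solve (M ∷ K ∷ u ∷ y ∷ []) ℚ-ring ⟩
    (1ℚ + K) * (u + y) - (1ℚ + K) * u  ≡⟨ cong (_- (1ℚ + K) * u) eq ⟩
    (1ℚ + M) * u - (1ℚ + K) * u        ≡⟨ solve (M ∷ K ∷ u ∷ y ∷ []) ℚ-ring ⟩
    (M - K) * u                        ∎

upper-shift : ∀ n k →
  (1ℚ + toℚ n) * toℚ ((n ℕ.+ suc k) C k) ≡ (1ℚ + (toℚ n + toℚ k)) * toℚ ((n ℕ.+ k) C k)
upper-shift n k = begin
  (1ℚ + toℚ n) * toℚ ((n ℕ.+ suc k) C k)
    ≡⟨ cong (_* toℚ ((n ℕ.+ suc k) C k)) (toℚ-suc n) ⟨
  toℚ (suc n) * toℚ ((n ℕ.+ suc k) C k)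
    ≡⟨ toℚ-*-≡ (suc n) _ (n ℕ.+ suc k) _ ([n+1]*[n+k+1]Ck≡[n+k+1]*[n+k]Ck n k) ⟩
  toℚ (n ℕ.+ suc k) * toℚ ((n ℕ.+ k) C k)
    ≡⟨ cong (_* toℚ ((n ℕ.+ k) C k)) (toℚ-+-suc n k) ⟩
  (1ℚ + (toℚ n + toℚ k)) * toℚ ((n ℕ.+ k) C k)
    ∎

c : ℕ → ℕ → ℚ
c n k = toℚ (n C k) * toℚ ((n ℕ.+ k) C k)

a : ℕ → ℕ → ℚ
a n k = sign (n ℕ.+ k) * toℚ (n C k) * toℚ ((n ℕ.+ k) C k)

a≡sign*c : ∀ n k → a n k ≡ sign (n ℕ.+ k) * c n k
a≡sign*c n k = ℚ.*-assoc (sign (n ℕ.+ k)) (toℚ (n C k)) (toℚ ((n ℕ.+ k) C k))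

a-sucʳ : ∀ n k → a n (suc k) ≡ - sign (n ℕ.+ k) * c n (suc k)
a-sucʳ n k = trans (a≡sign*c n (suc k)) (cong (λ m → sign m * c n (suc k)) (ℕ.+-suc n k))

a-suc-suc : ∀ n k → a (suc n) (suc k) ≡ - - sign (n ℕ.+ k) * c (suc n) (suc k)
a-suc-suc n k =
  trans (a≡sign*c (suc n) (suc k)) (cong (λ m → sign (suc m) * c (suc n) (suc k)) (ℕ.+-suc n k))

a[n,1+n]≡0 : ∀ n → a n (suc n) ≡ 0ℚ
a[n,1+n]≡0 n = begin
  a n (suc n)                  ≡⟨ cong (λ z → sign (n ℕ.+ suc n) * toℚ z * v) (k>n⇒nCk≡0 (ℕ.n<1+n n)) ⟩
  sign (n ℕ.+ suc n) * 0ℚ * v  ≡⟨ cong (_* v) (ℚ.*-zeroʳ (sign (n ℕ.+ suc n))) ⟩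
  0ℚ * v                       ≡⟨ ℚ.*-zeroˡ v ⟩
  0ℚ                           ∎
  where
  v = toℚ ((n ℕ.+ suc n) C suc n)

c-sucʳ : ∀ n k → (1ℚ + toℚ k) * (1ℚ + toℚ k) * c n (suc k)
                 ≡ (toℚ n - toℚ k) * (1ℚ + (toℚ n + toℚ k)) * c n k
c-sucʳ n k = begin
  (1ℚ + K) * (1ℚ + K) * (toℚ (n C suc k) * toℚ ((n ℕ.+ suc k) C suc k))
    ≡⟨ interchange (1ℚ + K) (1ℚ + K) _ _ ⟩
  ((1ℚ + K) * toℚ (n C suc k)) * ((1ℚ + K) * toℚ ((n ℕ.+ suc k) C suc k))
    ≡⟨ cong₂ _*_ (absorption-below n k) diagonal ⟩
  ((toℚ n - K) * toℚ (n C k)) * ((1ℚ + (toℚ n + K)) * toℚ ((n ℕ.+ k) C k))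
    ≡⟨ interchange (toℚ n - K) _ _ _ ⟩
  (toℚ n - K) * (1ℚ + (toℚ n + K)) * c n k
    ∎
  where
  K = toℚ k
  diagonal : (1ℚ + K) * toℚ ((n ℕ.+ suc k) C suc k) ≡ (1ℚ + (toℚ n + K)) * toℚ ((n ℕ.+ k) C k)
  diagonal = begin
    (1ℚ + K) * toℚ ((n ℕ.+ suc k) C suc k)
      ≡⟨ cong (λ m → (1ℚ + K) * toℚ (m C suc k)) (ℕ.+-suc n k) ⟩
    (1ℚ + K) * toℚ (suc (n ℕ.+ k) C suc k)
      ≡⟨ absorption (n ℕ.+ k) k ⟩
    (1ℚ + toℚ (n ℕ.+ k)) * toℚ ((n ℕ.+ k) C k)
      ≡⟨ cong (λ z → (1ℚ + z) * toℚ ((n ℕ.+ k) C k)) (toℚ-+ n k) ⟩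
    (1ℚ + (toℚ n + K)) * toℚ ((n ℕ.+ k) C k)
      ∎

c-suc-suc : ∀ n k → (1ℚ + toℚ k) * (1ℚ + toℚ k) * c (suc n) (suc k)
                    ≡ (1ℚ + (toℚ n + toℚ k)) * (1ℚ + (1ℚ + (toℚ n + toℚ k))) * c n k
c-suc-suc n k = begin
  (1ℚ + K) * (1ℚ + K) * (toℚ (suc n C suc k) * toℚ (suc (n ℕ.+ suc k) C suc k))
    ≡⟨ interchange (1ℚ + K) (1ℚ + K) _ _ ⟩
  ((1ℚ + K) * toℚ (suc n C suc k)) * ((1ℚ + K) * toℚ (suc (n ℕ.+ suc k) C suc k))
    ≡⟨ cong₂ _*_ (absorption n k) (absorption (n ℕ.+ suc k) k) ⟩
  ((1ℚ + N) * u) * ((1ℚ + toℚ (n ℕ.+ suc k)) * t)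
    ≡⟨ regroup (1ℚ + N) (1ℚ + toℚ (n ℕ.+ suc k)) u t ⟩
  (1ℚ + toℚ (n ℕ.+ suc k)) * u * ((1ℚ + N) * t)
    ≡⟨ cong₂ (λ x y → (1ℚ + x) * u * y) (toℚ-+-suc n k) (upper-shift n k) ⟩
  (1ℚ + (1ℚ + (N + K))) * u * ((1ℚ + (N + K)) * v)
    ≡⟨ regroup′ (1ℚ + (N + K)) (1ℚ + (1ℚ + (N + K))) u v ⟩
  (1ℚ + (N + K)) * (1ℚ + (1ℚ + (N + K))) * c n k
    ∎
  where
  N = toℚ n
  K = toℚ k
  u = toℚ (n C k)
  v = toℚ ((n ℕ.+ k) C k)
  t = toℚ ((n ℕ.+ suc k) C k)
  regroup : ∀ x y u t → (x * u) * (y * t) ≡ y * u * (x * t)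
  regroup = solve-∀ ℚ-ring
  regroup′ : ∀ x y u v → y * u * (x * v) ≡ x * y * (u * v)
  regroup′ = solve-∀ ℚ-ring

-- Both shifted coefficients are polynomial multiples of c n k once multiplied by (1 + k)².
c-recurrence : ∀ n k →
  (1ℚ + toℚ n) * (c (suc n) (suc k) + c n (suc k))
  ≡ 2ℚ * ((1ℚ + (toℚ n + toℚ k)) * c n k + (1ℚ + (toℚ n + (1ℚ + toℚ k))) * c n (suc k))
c-recurrence n k = *-cancelˡ-[1+k] k (*-cancelˡ-[1+k] k
  (cleared (toℚ n) (toℚ k) (c n k) (c (suc n) (suc k)) (c n (suc k)) (c-suc-suc n k) (c-sucʳ n k)))
  where
  cleared : ∀ N K c c′ c″ →
    (1ℚ + K) * (1ℚ + K) * c′ ≡ (1ℚ + (N + K)) * (1ℚ + (1ℚ + (N + K))) * c →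
    (1ℚ + K) * (1ℚ + K) * c″ ≡ (N - K) * (1ℚ + (N + K)) * c →
    (1ℚ + K) * ((1ℚ + K) * ((1ℚ + N) * (c′ + c″)))
    ≡ (1ℚ + K) * ((1ℚ + K) * (2ℚ * ((1ℚ + (N + K)) * c + (1ℚ + (N + (1ℚ + K))) * c″)))
  cleared N K c c′ c″ eq′ eq″ = begin
    (1ℚ + K) * ((1ℚ + K) * ((1ℚ + N) * (c′ + c″)))
      ≡⟨ solve (N ∷ K ∷ c′ ∷ c″ ∷ []) ℚ-ring ⟩
    (1ℚ + N) * ((1ℚ + K) * (1ℚ + K) * c′ + (1ℚ + K) * (1ℚ + K) * c″)
      ≡⟨ cong₂ (λ x y → (1ℚ + N) * (x + y)) eq′ eq″ ⟩
    (1ℚ + N) * ((1ℚ + (N + K)) * (1ℚ + (1ℚ + (N + K))) * c + (N - K) * (1ℚ + (N + K)) * c)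
      ≡⟨ solve (N ∷ K ∷ c ∷ []) ℚ-ring ⟩
    (1ℚ + K) * ((1ℚ + K) * (2ℚ * ((1ℚ + (N + K)) * c)))
      + 2ℚ * (1ℚ + (N + (1ℚ + K))) * ((N - K) * (1ℚ + (N + K)) * c)
      ≡⟨ cong (λ x → (1ℚ + K) * ((1ℚ + K) * (2ℚ * ((1ℚ + (N + K)) * c)))
                     + 2ℚ * (1ℚ + (N + (1ℚ + K))) * x) eq″ ⟨
    (1ℚ + K) * ((1ℚ + K) * (2ℚ * ((1ℚ + (N + K)) * c)))
      + 2ℚ * (1ℚ + (N + (1ℚ + K))) * ((1ℚ + K) * (1ℚ + K) * c″)
      ≡⟨ solve (N ∷ K ∷ c ∷ c″ ∷ []) ℚ-ring ⟩
    (1ℚ + K) * ((1ℚ + K) * (2ℚ * ((1ℚ + (N + K)) * c + (1ℚ + (N + (1ℚ + K))) * c″)))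
      ∎

c-sucʳ-weighted : ∀ n k →
  toℚ n * (1ℚ + toℚ n) * c n k ≡ (1ℚ + toℚ k) * (toℚ k * c n k + (1ℚ + toℚ k) * c n (suc k))
c-sucʳ-weighted n k = rearranged (toℚ n) (toℚ k) (c n k) (c n (suc k)) (c-sucʳ n k)
  where
  rearranged : ∀ N K c c″ → (1ℚ + K) * (1ℚ + K) * c″ ≡ (N - K) * (1ℚ + (N + K)) * c →
               N * (1ℚ + N) * c ≡ (1ℚ + K) * (K * c + (1ℚ + K) * c″)
  rearranged N K c c″ eq = begin
    N * (1ℚ + N) * c                                   ≡⟨ solve (N ∷ K ∷ c ∷ []) ℚ-ring ⟩
    (1ℚ + K) * (K * c) + (N - K) * (1ℚ + (N + K)) * c  ≡⟨ cong ((1ℚ + K) * (K * c) +_) eq ⟨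
    (1ℚ + K) * (K * c) + (1ℚ + K) * (1ℚ + K) * c″      ≡⟨ solve (N ∷ K ∷ c ∷ c″ ∷ []) ℚ-ring ⟩
    (1ℚ + K) * (K * c + (1ℚ + K) * c″)                 ∎

P : ℕ → ℕ → ℚ
P n zero    = 0ℚ
P n (suc k) = (1ℚ + (toℚ n + toℚ k)) * a n k

a-recurrence : ∀ n k → (1ℚ + toℚ n) * (a (suc n) k - a n k) ≡ 2ℚ * (P n k - P n (suc k))
a-recurrence n zero = at-zero (sign (n ℕ.+ 0)) (toℚ n)
  where
  at-zero : ∀ σ N →
    (1ℚ + N) * (- σ * 1ℚ * 1ℚ - σ * 1ℚ * 1ℚ) ≡ 2ℚ * (0ℚ - (1ℚ + (N + 0ℚ)) * (σ * 1ℚ * 1ℚ))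
  at-zero = solve-∀ ℚ-ring
a-recurrence n (suc k) = begin
  (1ℚ + N) * (a (suc n) (suc k) - a n (suc k))
    ≡⟨ cong₂ (λ x y → (1ℚ + N) * (x - y)) (a-suc-suc n k) (a-sucʳ n k) ⟩
  (1ℚ + N) * (- - σ * c (suc n) (suc k) - - σ * c n (suc k))
    ≡⟨ signed σ N K (c n k) (c (suc n) (suc k)) (c n (suc k)) (c-recurrence n k) ⟩
  2ℚ * ((1ℚ + (N + K)) * (σ * c n k) - (1ℚ + (N + (1ℚ + K))) * (- σ * c n (suc k)))
    ≡⟨ cong₂ (λ x y → 2ℚ * ((1ℚ + (N + K)) * x - (1ℚ + (N + (1ℚ + K))) * y))
             (a≡sign*c n k) (a-sucʳ n k) ⟨
  2ℚ * ((1ℚ + (N + K)) * a n k - (1ℚ + (N + (1ℚ + K))) * a n (suc k))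
    ≡⟨ cong (λ x → 2ℚ * (P n (suc k) - (1ℚ + (N + x)) * a n (suc k))) (toℚ-suc k) ⟨
  2ℚ * (P n (suc k) - P n (suc (suc k)))
    ∎
  where
  N = toℚ n
  K = toℚ k
  σ = sign (n ℕ.+ k)
  signed : ∀ σ N K c c′ c″ →
    (1ℚ + N) * (c′ + c″) ≡ 2ℚ * ((1ℚ + (N + K)) * c + (1ℚ + (N + (1ℚ + K))) * c″) →
    (1ℚ + N) * (- - σ * c′ - - σ * c″)
    ≡ 2ℚ * ((1ℚ + (N + K)) * (σ * c) - (1ℚ + (N + (1ℚ + K))) * (- σ * c″))
  signed σ N K c c′ c″ eq = begin
    (1ℚ + N) * (- - σ * c′ - - σ * c″)
      ≡⟨ solve (σ ∷ N ∷ c′ ∷ c″ ∷ []) ℚ-ring ⟩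
    σ * ((1ℚ + N) * (c′ + c″))
      ≡⟨ cong (σ *_) eq ⟩
    σ * (2ℚ * ((1ℚ + (N + K)) * c + (1ℚ + (N + (1ℚ + K))) * c″))
      ≡⟨ solve (σ ∷ N ∷ K ∷ c ∷ c″ ∷ []) ℚ-ring ⟩
    2ℚ * ((1ℚ + (N + K)) * (σ * c) - (1ℚ + (N + (1ℚ + K))) * (- σ * c″))
      ∎

G : ℕ → ℕ → ℚ
G n k = toℚ k * a n k

a*1/suc-telescopes : ∀ n j → (1ℚ + toℚ n) * (toℚ n * (a n j * 1/suc j)) ≡ G n j - G n (suc j)
a*1/suc-telescopes n j = begin
  (1ℚ + N) * (N * (a n j * 1/suc j))
    ≡⟨ cong (λ x → (1ℚ + N) * (N * (x * 1/suc j))) (a≡sign*c n j) ⟩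
  (1ℚ + N) * (N * (σ * c n j * 1/suc j))
    ≡⟨ signed σ N J (c n j) (c n (suc j)) (1/suc j) ([1+k]*1/suc≡1 j) (c-sucʳ-weighted n j) ⟩
  J * (σ * c n j) - (1ℚ + J) * (- σ * c n (suc j))
    ≡⟨ cong₂ (λ x y → J * x - y) (a≡sign*c n j) (cong₂ _*_ (toℚ-suc j) (a-sucʳ n j)) ⟨
  G n j - G n (suc j)
    ∎
  where
  N = toℚ n
  J = toℚ j
  σ = sign (n ℕ.+ j)
  signed : ∀ σ N J c c″ ι → (1ℚ + J) * ι ≡ 1ℚ →
    N * (1ℚ + N) * c ≡ (1ℚ + J) * (J * c + (1ℚ + J) * c″) →
    (1ℚ + N) * (N * (σ * c * ι)) ≡ J * (σ * c) - (1ℚ + J) * (- σ * c″)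
  signed σ N J c c″ ι ι-inv eq = begin
    (1ℚ + N) * (N * (σ * c * ι))
      ≡⟨ solve (σ ∷ N ∷ c ∷ ι ∷ []) ℚ-ring ⟩
    σ * ι * (N * (1ℚ + N) * c)
      ≡⟨ cong (σ * ι *_) eq ⟩
    σ * ι * ((1ℚ + J) * (J * c + (1ℚ + J) * c″))
      ≡⟨ solve (σ ∷ J ∷ c ∷ c″ ∷ ι ∷ []) ℚ-ring ⟩
    σ * ((1ℚ + J) * ι) * (J * c + (1ℚ + J) * c″)
      ≡⟨ cong (λ x → σ * x * (J * c + (1ℚ + J) * c″)) ι-inv ⟩
    σ * 1ℚ * (J * c + (1ℚ + J) * c″)
      ≡⟨ solve (σ ∷ J ∷ c ∷ c″ ∷ []) ℚ-ring ⟩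
    J * (σ * c) - (1ℚ + J) * (- σ * c″)
      ∎

-- Sums of the coefficients

sum0-a≡1 : ∀ n → sum0 n (a n) ≡ 1ℚ
sum0-a≡1 zero    = refl
sum0-a≡1 (suc n) = begin
  sum0 (suc n) (a (suc n))    ≡⟨ x∙y⁻¹≈ε⇒x≈y _ _ difference≡0 ⟩
  sum0 n (a n) + a n (suc n)  ≡⟨ cong₂ _+_ (sum0-a≡1 n) (a[n,1+n]≡0 n) ⟩
  1ℚ + 0ℚ                     ≡⟨ ℚ.+-identityʳ 1ℚ ⟩
  1ℚ                          ∎
  where
  N = toℚ n
  difference : (1ℚ + N) * (sum0 (suc n) (a (suc n)) - sum0 (suc n) (a n)) ≡ 0ℚ
  difference = begin
    (1ℚ + N) * (sum0 (suc n) (a (suc n)) - sum0 (suc n) (a n))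
      ≡⟨ cong ((1ℚ + N) *_) (sum1-- (suc (suc n)) (λ k → a (suc n) (pred k)) (λ k → a n (pred k))) ⟨
    (1ℚ + N) * sum0 (suc n) (λ k → a (suc n) k - a n k)
      ≡⟨ sum1-*ˡ (suc (suc n)) (1ℚ + N) (λ k → a (suc n) (pred k) - a n (pred k)) ⟨
    sum0 (suc n) (λ k → (1ℚ + N) * (a (suc n) k - a n k))
      ≡⟨ sum1-cong (suc (suc n)) (λ k → a-recurrence n k) ⟩
    sum0 (suc n) (λ k → 2ℚ * (P n k - P n (suc k)))
      ≡⟨ sum1-*ˡ (suc (suc n)) 2ℚ (λ k → P n (pred k) - P n (suc (pred k))) ⟩
    2ℚ * sum0 (suc n) (λ k → P n k - P n (suc k))
      ≡⟨ cong (2ℚ *_) (sum0-telescope (suc n) (P n)) ⟩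
    2ℚ * (0ℚ - (1ℚ + (N + toℚ (suc n))) * a n (suc n))
      ≡⟨ cong (λ x → 2ℚ * (0ℚ - (1ℚ + (N + toℚ (suc n))) * x)) (a[n,1+n]≡0 n) ⟩
    2ℚ * (0ℚ - (1ℚ + (N + toℚ (suc n))) * 0ℚ)
      ≡⟨ vanish (1ℚ + (N + toℚ (suc n))) ⟩
    0ℚ
      ∎
    where
    vanish : ∀ x → 2ℚ * (0ℚ - x * 0ℚ) ≡ 0ℚ
    vanish = solve-∀ ℚ-ring
  difference≡0 : sum0 (suc n) (a (suc n)) - sum0 (suc n) (a n) ≡ 0ℚ
  difference≡0 = *-cancelˡ-[1+k] n (trans difference (sym (ℚ.*-zeroʳ (1ℚ + N))))

n*sum0-a*1/suc≡0 : ∀ n → toℚ n * sum0 n (λ j → a n j * 1/suc j) ≡ 0ℚ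
n*sum0-a*1/suc≡0 n = *-cancelˡ-[1+k] n (begin
  (1ℚ + N) * (N * sum0 n f)
    ≡⟨ cong ((1ℚ + N) *_) (sum1-*ˡ (suc n) N (λ j → f (pred j))) ⟨
  (1ℚ + N) * sum0 n (λ j → N * f j)
    ≡⟨ sum1-*ˡ (suc n) (1ℚ + N) (λ j → N * f (pred j)) ⟨
  sum0 n (λ j → (1ℚ + N) * (N * f j))
    ≡⟨ sum1-cong (suc n) (λ j → a*1/suc-telescopes n j) ⟩
  sum0 n (λ j → G n j - G n (suc j))
    ≡⟨ sum0-telescope n (G n) ⟩
  0ℚ * a n 0 - toℚ (suc n) * a n (suc n)
    ≡⟨ cong (λ x → 0ℚ * a n 0 - toℚ (suc n) * x) (a[n,1+n]≡0 n) ⟩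
  0ℚ * a n 0 - toℚ (suc n) * 0ℚ
    ≡⟨ vanish (a n 0) (toℚ (suc n)) (1ℚ + N) ⟩
  (1ℚ + N) * 0ℚ
    ∎)
  where
  N = toℚ n
  f = λ j → a n j * 1/suc j
  vanish : ∀ x y z → 0ℚ * x - y * 0ℚ ≡ z * 0ℚ
  vanish = solve-∀ ℚ-ring

sum1-ΔP*H : ∀ n → sum1 (suc n) (λ k → (P n k - P n (suc k)) * H k)
                  ≡ sum0 n (a n) + toℚ n * sum0 n (λ j → a n j * 1/suc j)
sum1-ΔP*H n = begin
  sum1 (suc n) (λ k → (P n k - P n (suc k)) * H k)
    ≡⟨ sum1-by-parts (suc n) (P n) H ⟩
  Σ + (P n 1 * 0ℚ - (1ℚ + (N + toℚ (suc n))) * a n (suc n) * H (suc n))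
    ≡⟨ cong (λ x → Σ + (P n 1 * 0ℚ - (1ℚ + (N + toℚ (suc n))) * x * H (suc n))) (a[n,1+n]≡0 n) ⟩
  Σ + (P n 1 * 0ℚ - (1ℚ + (N + toℚ (suc n))) * 0ℚ * H (suc n))
    ≡⟨ boundary Σ (P n 1) (1ℚ + (N + toℚ (suc n))) (H (suc n)) ⟩
  Σ
    ≡⟨ sum1-cong (suc n) (λ j → P-increment j) ⟩
  sum0 n (λ j → a n j + N * (a n j * 1/suc j))
    ≡⟨ sum1-+ (suc n) (λ j → a n (pred j)) (λ j → N * (a n (pred j) * 1/suc (pred j))) ⟩
  sum0 n (a n) + sum0 n (λ j → N * (a n j * 1/suc j))
    ≡⟨ cong (sum0 n (a n) +_) (sum1-*ˡ (suc n) N (λ j → a n (pred j) * 1/suc (pred j))) ⟩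
  sum0 n (a n) + N * sum0 n (λ j → a n j * 1/suc j)
    ∎
  where
  N = toℚ n
  Σ = sum1 (suc n) (λ k → P n k * (H k - H (pred k)))
  boundary : ∀ s x y h → s + (x * 0ℚ - y * 0ℚ * h) ≡ s
  boundary = solve-∀ ℚ-ring
  P-increment : ∀ j → P n (suc j) * (H (suc j) - H j) ≡ a n j + N * (a n j * 1/suc j)
  P-increment j = split N (toℚ j) (a n j) (H j) (1/suc j) ([1+k]*1/suc≡1 j)
    where
    split : ∀ N J x h ι → (1ℚ + J) * ι ≡ 1ℚ →
      (1ℚ + (N + J)) * x * ((h + ι) - h) ≡ x + N * (x * ι)
    split N J x h ι ι-inv = begin
      (1ℚ + (N + J)) * x * ((h + ι) - h)  ≡⟨ solve (N ∷ J ∷ x ∷ h ∷ ι ∷ []) ℚ-ring ⟩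
      x * ((1ℚ + J) * ι) + N * (x * ι)    ≡⟨ cong (λ y → x * y + N * (x * ι)) ι-inv ⟩
      x * 1ℚ + N * (x * ι)                ≡⟨ cong (_+ N * (x * ι)) (ℚ.*-identityʳ x) ⟩
      x + N * (x * ι)                     ∎

S : ℕ → ℚ
S n = sum1 n (λ k → a n k * H k)

S≡sum1-suc : ∀ n → S n ≡ sum1 (suc n) (λ k → a n k * H k)
S≡sum1-suc n = sym (begin
  S n + a n (suc n) * H (suc n)  ≡⟨ cong (λ x → S n + x * H (suc n)) (a[n,1+n]≡0 n) ⟩
  S n + 0ℚ * H (suc n)           ≡⟨ cong (S n +_) (ℚ.*-zeroˡ (H (suc n))) ⟩
  S n + 0ℚ                       ≡⟨ ℚ.+-identityʳ (S n) ⟩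
  S n                            ∎)

S-recurrence : ∀ n → (1ℚ + toℚ n) * (S (suc n) - S n) ≡ 2ℚ
S-recurrence n = begin
  (1ℚ + N) * (S (suc n) - S n)
    ≡⟨ cong (λ x → (1ℚ + N) * (S (suc n) - x)) (S≡sum1-suc n) ⟩
  (1ℚ + N) * (sum1 (suc n) (λ k → a (suc n) k * H k) - sum1 (suc n) (λ k → a n k * H k))
    ≡⟨ cong ((1ℚ + N) *_) (sum1-- (suc n) (λ k → a (suc n) k * H k) (λ k → a n k * H k)) ⟨
  (1ℚ + N) * sum1 (suc n) (λ k → a (suc n) k * H k - a n k * H k)
    ≡⟨ sum1-*ˡ (suc n) (1ℚ + N) (λ k → a (suc n) k * H k - a n k * H k) ⟨
  sum1 (suc n) (λ k → (1ℚ + N) * (a (suc n) k * H k - a n k * H k))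
    ≡⟨ sum1-cong (suc n) (λ k → summand (suc k)) ⟩
  sum1 (suc n) (λ k → 2ℚ * ((P n k - P n (suc k)) * H k))
    ≡⟨ sum1-*ˡ (suc n) 2ℚ (λ k → (P n k - P n (suc k)) * H k) ⟩
  2ℚ * sum1 (suc n) (λ k → (P n k - P n (suc k)) * H k)
    ≡⟨ cong (2ℚ *_) (sum1-ΔP*H n) ⟩
  2ℚ * (sum0 n (a n) + N * sum0 n (λ j → a n j * 1/suc j))
    ≡⟨ cong₂ (λ x y → 2ℚ * (x + y)) (sum0-a≡1 n) (n*sum0-a*1/suc≡0 n) ⟩
  2ℚ * (1ℚ + 0ℚ)
    ≡⟨⟩
  2ℚ
    ∎
  where
  N = toℚ n
  summand : ∀ k →
    (1ℚ + N) * (a (suc n) k * H k - a n k * H k) ≡ 2ℚ * ((P n k - P n (suc k)) * H k)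
  summand k = begin
    (1ℚ + N) * (a (suc n) k * H k - a n k * H k) ≡⟨ factor (1ℚ + N) (a (suc n) k) (a n k) (H k) ⟩
    ((1ℚ + N) * (a (suc n) k - a n k)) * H k     ≡⟨ cong (_* H k) (a-recurrence n k) ⟩
    (2ℚ * (P n k - P n (suc k))) * H k           ≡⟨ ℚ.*-assoc 2ℚ (P n k - P n (suc k)) (H k) ⟩
    2ℚ * ((P n k - P n (suc k)) * H k)           ∎
    where
    factor : ∀ x y z h → x * (y * h - z * h) ≡ (x * (y - z)) * h
    factor = solve-∀ ℚ-ring

S≡2H : ∀ n → S n ≡ 2ℚ * H n
S≡2H zero    = refl
S≡2H (suc n) = begin
  S (suc n)                ≡⟨ x≡y+[x-y] (S (suc n)) (S n) ⟩
  S n + (S (suc n) - S n)  ≡⟨ cong₂ _+_ (S≡2H n) increment ⟩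
  2ℚ * H n + 2ℚ * 1/suc n  ≡⟨ ℚ.*-distribˡ-+ 2ℚ (H n) (1/suc n) ⟨
  2ℚ * H (suc n)           ∎
  where
  x≡y+[x-y] : ∀ x y → x ≡ y + (x - y)
  x≡y+[x-y] = solve-∀ ℚ-ring
  increment : S (suc n) - S n ≡ 2ℚ * 1/suc n
  increment = *-cancelˡ-[1+k] n (begin
    (1ℚ + toℚ n) * (S (suc n) - S n)  ≡⟨ S-recurrence n ⟩
    2ℚ                                ≡⟨ ℚ.*-identityʳ 2ℚ ⟨
    2ℚ * 1ℚ                           ≡⟨ cong (2ℚ *_) ([1+k]*1/suc≡1 n) ⟨
    2ℚ * ((1ℚ + toℚ n) * 1/suc n)     ≡⟨ x∙yz≈y∙xz 2ℚ (1ℚ + toℚ n) (1/suc n) ⟩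
    (1ℚ + toℚ n) * (2ℚ * 1/suc n)     ∎)

mainTheorem3 : (n : ℕ) →
    H n ≡ ½ * sum1 n (λ k → sign (n ℕ.+ k) * toℚ (n C k) * toℚ ((n ℕ.+ k) C k) * H k)
mainTheorem3 n = begin
  H n             ≡⟨ ℚ.*-identityˡ (H n) ⟨
  (½ * 2ℚ) * H n  ≡⟨ ℚ.*-assoc ½ 2ℚ (H n) ⟩
  ½ * (2ℚ * H n)  ≡⟨ cong (½ *_) (S≡2H n) ⟨
  ½ * S n         ∎
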